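{- Let $p$ be a distribution over $[n]$ with $\|p\|_2^2\le U$, and let $\mathcal{U}$ be a uniformly random subset of $[n]$ of size $l$. If $l\ge 100\cdot U\cdot n$, then with probability at least $0.95$: (1) $\sum_{i\in\mathcal{U}}p_i=\Theta(l/n)$; and (2) $\|p_{|\mathcal{U}}\|_2^2=O(U\cdot n/l)$.
   Context: For $\mathcal{U}\subseteq[n]$, $p_{|\mathcal{U}}$ denotes $p$ conditioned on $\mathcal{U}$: the distribution on $\mathcal{U}$ with $p_{|\mathcal{U}}(j)=p(j)/\sum_{i\in\mathcal{U}}p(i)$. The constants in $\Theta,O$ are absolute.
   Formalization: The distribution p takes rational values, and the bound U is a rational number. -}

module Defs where

open import Data.Nat as ℕ using (ℕ; zero; suc)
open import Data.Integer using (+_)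
open import Data.Rational using (ℚ; 0ℚ; _/_; _+_; _*_; _≤_; _<_)
open import Data.Fin using (Fin; zero; suc)
open import Data.Fin.Subset using (Subset; Side; inside; outside; ∣_∣)
open import Data.Vec using (Vec; []; _∷_; lookup)
open import Data.List using (List; []; _∷_; _++_; map; filter; length)
open import Data.Product using (_×_)
open import Relation.Nullary using (Dec)
open import Relation.Nullary.Decidable using (_×-dec_)
import Data.Rational.Properties as ℚP
import Data.Nat.Properties as ℕP
open import Relation.Binary.PropositionalEquality using (_≡_)

ℕtoℚ : ℕ → ℚ
ℕtoℚ k = + k / 1

sumFin : (n : ℕ) → (Fin n → ℚ) → ℚ
sumFin zero    f = 0ℚ
sumFin (suc n) f = f zero + sumFin n (λ i → f (suc i))

IsDistribution : (n : ℕ) → (Fin n → ℚ) → Set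
IsDistribution n p = ((i : Fin n) → 0ℚ ≤ p i) × (sumFin n p ≡ ℕtoℚ 1)

normSq : (n : ℕ) → (Fin n → ℚ) → ℚ
normSq n p = sumFin n (λ i → p i * p i)

restrict : {n : ℕ} → Subset n → (Fin n → ℚ) → Fin n → ℚ
restrict S f i with lookup S i
... | inside  = f i
... | outside = 0ℚ

mass : (n : ℕ) → (Fin n → ℚ) → Subset n → ℚ
mass n p S = sumFin n (restrict S p)

-- Σ_{i ∈ S} p_i²  (so that ‖p_{|S}‖₂² = sqMass / mass²)
sqMass : (n : ℕ) → (Fin n → ℚ) → Subset n → ℚ
sqMass n p S = sumFin n (restrict S (λ i → p i * p i))

allSubsets : (n : ℕ) → List (Subset n)
allSubsets zero    = [] ∷ []
allSubsets (suc n) = map (inside ∷_) (allSubsets n) ++ map (outside ∷_) (allSubsets n)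

countSubsets : (n l : ℕ) → (P : Subset n → Set) → ((S : Subset n) → Dec (P S)) → ℕ
countSubsets n l P P? = length (filter (λ S → (∣ S ∣ ℕ.≟ l) ×-dec P? S) (allSubsets n))

-- The "good" event for a subset S of size l, with constants c₁, c₂, C:
--  (1) c₁·l/n ≤ Σ_{i∈S} p_i ≤ c₂·l/n
--  (2) ‖p_{|S}‖₂² = (Σ_{i∈S} p_i²)/(Σ_{i∈S} p_i)² ≤ C·U·n/l,
--      written multiplicatively (denominators cleared; the masses are positive by (1) when l > 0).
Good : (c₁ c₂ C : ℚ) (n : ℕ) (p : Fin n → ℚ) (U : ℚ) (l : ℕ) → Subset n → Set
Good c₁ c₂ C n p U l S =
  ((c₁ * ℕtoℚ l ≤ mass n p S * ℕtoℚ n) × (mass n p S * ℕtoℚ n ≤ c₂ * ℕtoℚ l))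
  × (sqMass n p S * ℕtoℚ l ≤ C * U * ℕtoℚ n * (mass n p S * mass n p S))

good? : (c₁ c₂ C : ℚ) (n : ℕ) (p : Fin n → ℚ) (U : ℚ) (l : ℕ) → (S : Subset n) → Dec (Good c₁ c₂ C n p U l S)
good? c₁ c₂ C n p U l S =
  ((c₁ * ℕtoℚ l ℚP.≤? mass n p S * ℕtoℚ n) ×-dec (mass n p S * ℕtoℚ n ℚP.≤? c₂ * ℕtoℚ l))
  ×-dec (sqMass n p S * ℕtoℚ l ℚP.≤? C * U * ℕtoℚ n * (mass n p S * mass n p S))

{-# OPTIONS --safe #-}
-- Second-moment method over the l-subsets S of [n]. Each point lies in C(n-1,l-1) = (l/n)·C(n,l)
-- of them and each pair of points in C(n-2,l-2); summing over S therefore gives the first two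
-- moments of the mass X(S) = Σ_{i∈S} p_i, and since Σ p = 1 the deviation n·X(S) − l has mean
-- square at most n·l·‖p‖₂² ≤ l²/100. By Chebyshev, |n·X(S) − l| ≥ l/2 for at most 4% of the
-- subsets. Likewise Σ_{i∈S} p_i² has mean (l/n)·‖p‖₂², so by Markov it exceeds 100·U·l/n for at
-- most 1% of them. Every other S is good for c₁ = 1/2, c₂ = 3/2 and K = 400, because
-- n·X(S) ≥ l/2 makes 100·U·l/n at most 400·U·(n/l)·X(S)².
module Submission where

open import Defs
open import Data.Bool.Base using (Bool; true; false; _∧_)
open import Data.Empty using (⊥-elim)
open import Data.Fin.Base using (Fin; zero; suc)
open import Data.Fin.Subset using (Subset; inside; outside; ∣_∣)
open import Data.List.Base using (List; []; _∷_; _++_; map; filter; length)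
open import Data.Product.Base using (_×_; _,_)
open import Data.Sum.Base using (_⊎_; inj₁; inj₂; [_,_]′)
open import Data.Vec.Base using ([]; _∷_; lookup)
open import Function.Base using (_∘_)
open import Relation.Binary.PropositionalEquality
open import Relation.Nullary using (Dec; yes; no; does; ¬_)

module _ where
  import Data.Integer.Base as ℤ
  import Data.Integer.Properties as ℤ
  open import Data.Nat.Base as ℕ using (ℕ; zero; suc)
  import Data.Nat.Properties as ℕ
  import Data.Nat.Coprimality as Coprime
  open import Data.Nat.Combinatorics using (_C_; nCk+nC[k+1]≡[n+1]C[k+1])
  open import Data.Rational.Base as ℚ using (ℚ; mkℚ; 0ℚ; 1ℚ; _+_; _*_; _-_; -_; _≤_; _<_; _/_)
  import Data.Rational.Properties as ℚ
  open import Level using (0ℓ)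
  open import Relation.Nullary.Decidable.Core using (dec⇒maybe)
  open import Tactic.RingSolver using (solve-∀)
  open import Tactic.RingSolver.Core.AlmostCommutativeRing
    using (AlmostCommutativeRing; fromCommutativeRing)

  ℚ-ring : AlmostCommutativeRing 0ℓ 0ℓ
  ℚ-ring = fromCommutativeRing ℚ.+-*-commutativeRing (λ x → dec⇒maybe (0ℚ ℚ.≟ x))

  ℕtoℚ≡mkℚ : ∀ k → ℕtoℚ k ≡ mkℚ (ℤ.+ k) 0 (Coprime.sym (Coprime.1-coprimeTo k))
  ℕtoℚ≡mkℚ k = ℚ.normalize-coprime (Coprime.sym (Coprime.1-coprimeTo k))

  ℕtoℚ-+ : ∀ a b → ℕtoℚ (a ℕ.+ b) ≡ ℕtoℚ a + ℕtoℚ b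
  ℕtoℚ-+ a b rewrite ℕtoℚ≡mkℚ a | ℕtoℚ≡mkℚ b =
    ℚ./-cong (trans (ℤ.pos-+ a b) (sym (cong₂ ℤ._+_ (ℤ.*-identityʳ (ℤ.+ a)) (ℤ.*-identityʳ (ℤ.+ b)))))
             refl

  ℕtoℚ-* : ∀ a b → ℕtoℚ (a ℕ.* b) ≡ ℕtoℚ a * ℕtoℚ b
  ℕtoℚ-* a b rewrite ℕtoℚ≡mkℚ a | ℕtoℚ≡mkℚ b = ℚ./-cong (ℤ.pos-* a b) refl

  ℕtoℚ-mono-≤ : ∀ {a b} → a ℕ.≤ b → ℕtoℚ a ≤ ℕtoℚ b
  ℕtoℚ-mono-≤ {a} {b} a≤b rewrite ℕtoℚ≡mkℚ a | ℕtoℚ≡mkℚ b =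
    ℚ.*≤* (subst₂ ℤ._≤_ (sym (ℤ.*-identityʳ (ℤ.+ a))) (sym (ℤ.*-identityʳ (ℤ.+ b))) (ℤ.+≤+ a≤b))

  ℕtoℚ-cancel-≤ : ∀ {a b} → ℕtoℚ a ≤ ℕtoℚ b → a ℕ.≤ b
  ℕtoℚ-cancel-≤ {a} {b} a≤b rewrite ℕtoℚ≡mkℚ a | ℕtoℚ≡mkℚ b with a≤b
  ... | ℚ.*≤* a≤b = ℤ.drop‿+≤+ (subst₂ ℤ._≤_ (ℤ.*-identityʳ (ℤ.+ a)) (ℤ.*-identityʳ (ℤ.+ b)) a≤b)

  0≤ℕtoℚ : ∀ a → 0ℚ ≤ ℕtoℚ a
  0≤ℕtoℚ a = ℕtoℚ-mono-≤ {0} {a} ℕ.z≤n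

  0<1 : 0ℚ < 1ℚ
  0<1 = ℚ.positive⁻¹ 1ℚ

  p≤p+q : ∀ {p q} → 0ℚ ≤ q → p ≤ p + q
  p≤p+q {p} {q} 0≤q = subst (_≤ p + q) (ℚ.+-identityʳ p) (ℚ.+-monoʳ-≤ p 0≤q)

  p≤q+p : ∀ {p q} → 0ℚ ≤ q → p ≤ q + p
  p≤q+p {p} {q} 0≤q = subst (_≤ q + p) (ℚ.+-identityˡ p) (ℚ.+-monoˡ-≤ p 0≤q)

  p≤q⇒0≤q-p : ∀ {p q} → p ≤ q → 0ℚ ≤ q - p
  p≤q⇒0≤q-p {p} {q} p≤q = subst (_≤ q - p) (ℚ.+-inverseʳ p) (ℚ.+-monoˡ-≤ (- p) p≤q)

  0≤p*q : ∀ {p q} → 0ℚ ≤ p → 0ℚ ≤ q → 0ℚ ≤ p * q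
  0≤p*q {p} {q} 0≤p 0≤q =
    ℚ.nonNegative⁻¹ (p * q) {{ℚ.nonNeg*nonNeg⇒nonNeg p {{ℚ.nonNegative 0≤p}} q {{ℚ.nonNegative 0≤q}}}}

  0<p*q : ∀ {p q} → 0ℚ < p → 0ℚ < q → 0ℚ < p * q
  0<p*q {p} {q} 0<p 0<q =
    ℚ.positive⁻¹ (p * q) {{ℚ.pos*pos⇒pos p {{ℚ.positive 0<p}} q {{ℚ.positive 0<q}}}}

  0≤p*p : ∀ p → 0ℚ ≤ p * p
  0≤p*p p with ℚ.≤-total 0ℚ p
  ... | inj₁ 0≤p = 0≤p*q 0≤p 0≤p
  ... | inj₂ p≤0 =
    ℚ.nonNegative⁻¹ (p * p) {{ℚ.nonPos*nonPos⇒nonPos p {{ℚ.nonPositive p≤0}} p {{ℚ.nonPositive p≤0}}}}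

  *-monoˡ-≤ : ∀ {r p q} → 0ℚ ≤ r → p ≤ q → r * p ≤ r * q
  *-monoˡ-≤ {r} 0≤r = ℚ.*-monoˡ-≤-nonNeg r {{ℚ.nonNegative 0≤r}}

  *-monoʳ-≤ : ∀ {r p q} → 0ℚ ≤ r → p ≤ q → p * r ≤ q * r
  *-monoʳ-≤ {r} 0≤r = ℚ.*-monoʳ-≤-nonNeg r {{ℚ.nonNegative 0≤r}}

  *-mono-≤ : ∀ {p q r s} → 0ℚ ≤ p → p ≤ q → 0ℚ ≤ r → r ≤ s → p * r ≤ q * s
  *-mono-≤ 0≤p p≤q 0≤r r≤s = ℚ.≤-trans (*-monoˡ-≤ 0≤p r≤s) (*-monoʳ-≤ (ℚ.≤-trans 0≤r r≤s) p≤q)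

  *-cancelˡ-≤ : ∀ {r p q} → 0ℚ < r → r * p ≤ r * q → p ≤ q
  *-cancelˡ-≤ {r} 0<r = ℚ.*-cancelˡ-≤-pos r {{ℚ.positive 0<r}}

  sumFin-cong : ∀ n {f g : Fin n → ℚ} → (∀ i → f i ≡ g i) → sumFin n f ≡ sumFin n g
  sumFin-cong zero    f≡g = refl
  sumFin-cong (suc n) f≡g = cong₂ _+_ (f≡g zero) (sumFin-cong n (f≡g ∘ suc))

  sumFin-nonNeg : ∀ n {f : Fin n → ℚ} → (∀ i → 0ℚ ≤ f i) → 0ℚ ≤ sumFin n f
  sumFin-nonNeg zero    0≤f = ℚ.≤-refl
  sumFin-nonNeg (suc n) 0≤f = ℚ.+-mono-≤ (0≤f zero) (sumFin-nonNeg n (0≤f ∘ suc))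

  sumFin-ones : ∀ n → sumFin n (λ _ → 1ℚ) ≡ ℕtoℚ n
  sumFin-ones zero    = refl
  sumFin-ones (suc n) = trans (cong (1ℚ +_) (sumFin-ones n)) (sym (ℕtoℚ-+ 1 n))

  normSq-ones : ∀ n → normSq n (λ _ → 1ℚ) ≡ ℕtoℚ n
  normSq-ones n = trans (sumFin-cong n (λ _ → ℚ.*-identityˡ 1ℚ)) (sumFin-ones n)

  normSq-nonNeg : ∀ n (p : Fin n → ℚ) → 0ℚ ≤ normSq n p
  normSq-nonNeg n p = sumFin-nonNeg n (λ i → 0≤p*p (p i))

  normSq-pos : ∀ n {p : Fin n → ℚ} → (∀ i → 0ℚ ≤ p i) → 0ℚ < sumFin n p → 0ℚ < normSq n p
  normSq-pos zero    _   0<0 = ⊥-elim (ℚ.<-irrefl refl 0<0)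
  normSq-pos (suc n) {p} 0≤p 0<Σp with 0ℚ ℚ.<? p zero
  ... | yes 0<p₀ = ℚ.+-mono-<-≤ (0<p*q 0<p₀ 0<p₀) (normSq-nonNeg n (p ∘ suc))
  ... | no  0≮p₀ = ℚ.+-mono-≤-< (0≤p*p (p zero)) (normSq-pos n (0≤p ∘ suc) 0<Σp′)
    where
    p₀≡0 : p zero ≡ 0ℚ
    p₀≡0 = ℚ.≤-antisym (ℚ.≮⇒≥ 0≮p₀) (0≤p zero)
    0<Σp′ : 0ℚ < sumFin n (p ∘ suc)
    0<Σp′ = subst (0ℚ <_) (trans (cong (_+ sumFin n (p ∘ suc)) p₀≡0) (ℚ.+-identityˡ _)) 0<Σp

  sum≡1⇒0<n : ∀ n {p : Fin n → ℚ} → sumFin n p ≡ 1ℚ → 0ℚ < ℕtoℚ n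
  sum≡1⇒0<n zero    Σp≡1 = ⊥-elim (ℚ.1≢0 (sym Σp≡1))
  sum≡1⇒0<n (suc n) _    = ℚ.<-≤-trans 0<1 (ℕtoℚ-mono-≤ {1} {suc n} (ℕ.s≤s ℕ.z≤n))

  restrict-suc : ∀ {n} x (S : Subset n) (f : Fin (suc n) → ℚ) i →
    restrict (x ∷ S) f (suc i) ≡ restrict S (f ∘ suc) i
  restrict-suc x S f i with lookup S i
  ... | inside  = refl
  ... | outside = refl

  restrict-nonNeg : ∀ {n} (S : Subset n) {f : Fin n → ℚ} → (∀ i → 0ℚ ≤ f i) →
    ∀ i → 0ℚ ≤ restrict S f i
  restrict-nonNeg S 0≤f i with lookup S i
  ... | inside  = 0≤f i
  ... | outside = ℚ.≤-refl

  mass-inside : ∀ n (p : Fin (suc n) → ℚ) S → mass (suc n) p (inside ∷ S) ≡ p zero + mass n (p ∘ suc) S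
  mass-inside n p S = cong (p zero +_) (sumFin-cong n (restrict-suc inside S p))

  mass-outside : ∀ n (p : Fin (suc n) → ℚ) S → mass (suc n) p (outside ∷ S) ≡ mass n (p ∘ suc) S
  mass-outside n p S = trans (ℚ.+-identityˡ _) (sumFin-cong n (restrict-suc outside S p))

  mass-ones : ∀ n (S : Subset n) → mass n (λ _ → 1ℚ) S ≡ ℕtoℚ ∣ S ∣
  mass-ones zero    []            = refl
  mass-ones (suc n) (inside ∷ S)  =
    trans (mass-inside n (λ _ → 1ℚ) S) (trans (cong (1ℚ +_) (mass-ones n S)) (sym (ℕtoℚ-+ 1 ∣ S ∣)))
  mass-ones (suc n) (outside ∷ S) = trans (mass-outside n (λ _ → 1ℚ) S) (mass-ones n S)

  sqMass-nonNeg : ∀ n (p : Fin n → ℚ) S → 0ℚ ≤ sqMass n p S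
  sqMass-nonNeg n p S = sumFin-nonNeg n (restrict-nonNeg S (λ i → 0≤p*p (p i)))

  -- Sums over the subsets of a given size

  sumOfSize : (n l : ℕ) → (Subset n → ℚ) → ℚ
  sumOfSize zero    zero    F = F []
  sumOfSize zero    (suc l) F = 0ℚ
  sumOfSize (suc n) zero    F = sumOfSize n zero (F ∘ (outside ∷_))
  sumOfSize (suc n) (suc l) F =
    sumOfSize n l (F ∘ (inside ∷_)) + sumOfSize n (suc l) (F ∘ (outside ∷_))

  sumOfSize-cong : ∀ n l {F G : Subset n → ℚ} → (∀ S → ∣ S ∣ ≡ l → F S ≡ G S) →
    sumOfSize n l F ≡ sumOfSize n l G
  sumOfSize-cong zero    zero    F≡G = F≡G [] refl
  sumOfSize-cong zero    (suc l) F≡G = refl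
  sumOfSize-cong (suc n) zero    F≡G = sumOfSize-cong n zero (F≡G ∘ (outside ∷_))
  sumOfSize-cong (suc n) (suc l) F≡G = cong₂ _+_
    (sumOfSize-cong n l (λ S ∣S∣≡l → F≡G (inside ∷ S) (cong suc ∣S∣≡l)))
    (sumOfSize-cong n (suc l) (F≡G ∘ (outside ∷_)))

  sumOfSize-mono-≤ : ∀ n l {F G : Subset n → ℚ} → (∀ S → F S ≤ G S) →
    sumOfSize n l F ≤ sumOfSize n l G
  sumOfSize-mono-≤ zero    zero    F≤G = F≤G []
  sumOfSize-mono-≤ zero    (suc l) F≤G = ℚ.≤-refl
  sumOfSize-mono-≤ (suc n) zero    F≤G = sumOfSize-mono-≤ n zero (F≤G ∘ (outside ∷_))
  sumOfSize-mono-≤ (suc n) (suc l) F≤G =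
    ℚ.+-mono-≤ (sumOfSize-mono-≤ n l (F≤G ∘ (inside ∷_)))
               (sumOfSize-mono-≤ n (suc l) (F≤G ∘ (outside ∷_)))

  sumOfSize-+ : ∀ n l (F G : Subset n → ℚ) →
    sumOfSize n l (λ S → F S + G S) ≡ sumOfSize n l F + sumOfSize n l G
  sumOfSize-+ zero    zero    F G = refl
  sumOfSize-+ zero    (suc l) F G = refl
  sumOfSize-+ (suc n) zero    F G = sumOfSize-+ n zero (F ∘ (outside ∷_)) (G ∘ (outside ∷_))
  sumOfSize-+ (suc n) (suc l) F G =
    trans (cong₂ _+_ (sumOfSize-+ n l (F ∘ (inside ∷_)) (G ∘ (inside ∷_)))
                     (sumOfSize-+ n (suc l) (F ∘ (outside ∷_)) (G ∘ (outside ∷_))))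
          (interchange (sumOfSize n l (F ∘ (inside ∷_))) (sumOfSize n l (G ∘ (inside ∷_)))
                       (sumOfSize n (suc l) (F ∘ (outside ∷_)))
                       (sumOfSize n (suc l) (G ∘ (outside ∷_))))
    where
    interchange : ∀ a b c d → (a + b) + (c + d) ≡ (a + c) + (b + d)
    interchange = solve-∀ ℚ-ring

  sumOfSize-*ˡ : ∀ n l c (F : Subset n → ℚ) → sumOfSize n l (λ S → c * F S) ≡ c * sumOfSize n l F
  sumOfSize-*ˡ zero    zero    c F = refl
  sumOfSize-*ˡ zero    (suc l) c F = sym (ℚ.*-zeroʳ c)
  sumOfSize-*ˡ (suc n) zero    c F = sumOfSize-*ˡ n zero c _
  sumOfSize-*ˡ (suc n) (suc l) c F =
    trans (cong₂ _+_ (sumOfSize-*ˡ n l c _) (sumOfSize-*ˡ n (suc l) c _)) (sym (ℚ.*-distribˡ-+ c _ _))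

  sumOfSize-const : ∀ n l c → sumOfSize n l (λ _ → c) ≡ c * ℕtoℚ (n C l)
  sumOfSize-const zero    zero    c = sym (ℚ.*-identityʳ c)
  sumOfSize-const zero    (suc l) c = sym (ℚ.*-zeroʳ c)
  sumOfSize-const (suc n) zero    c = sumOfSize-const n zero c
  sumOfSize-const (suc n) (suc l) c = begin
    sumOfSize n l (λ _ → c) + sumOfSize n (suc l) (λ _ → c)
      ≡⟨ cong₂ _+_ (sumOfSize-const n l c) (sumOfSize-const n (suc l) c) ⟩
    c * ℕtoℚ (n C l) + c * ℕtoℚ (n C suc l)
      ≡⟨ ℚ.*-distribˡ-+ c _ _ ⟨
    c * (ℕtoℚ (n C l) + ℕtoℚ (n C suc l))
      ≡⟨ cong (c *_) (trans (sym (ℕtoℚ-+ (n C l) (n C suc l)))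
                            (cong ℕtoℚ (nCk+nC[k+1]≡[n+1]C[k+1] n l))) ⟩
    c * ℕtoℚ (suc n C suc l) ∎
    where open ≡-Reasoning

  𝟙 : Bool → ℚ
  𝟙 true  = 1ℚ
  𝟙 false = 0ℚ

  𝟙-∧ : ∀ a b → 𝟙 (a ∧ b) ≡ 𝟙 a * 𝟙 b
  𝟙-∧ true  b = sym (ℚ.*-identityˡ (𝟙 b))
  𝟙-∧ false b = sym (ℚ.*-zeroˡ (𝟙 b))

  sumList : {A : Set} → List A → (A → ℚ) → ℚ
  sumList []       f = 0ℚ
  sumList (x ∷ xs) f = f x + sumList xs f

  sumList-++ : ∀ {A : Set} (xs ys : List A) f → sumList (xs ++ ys) f ≡ sumList xs f + sumList ys f
  sumList-++ []       ys f = sym (ℚ.+-identityˡ _)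
  sumList-++ (x ∷ xs) ys f = trans (cong (f x +_) (sumList-++ xs ys f)) (sym (ℚ.+-assoc (f x) _ _))

  sumList-map : ∀ {A B : Set} (g : A → B) (xs : List A) f → sumList (map g xs) f ≡ sumList xs (f ∘ g)
  sumList-map g []       f = refl
  sumList-map g (x ∷ xs) f = cong (f (g x) +_) (sumList-map g xs f)

  sumList-cong : ∀ {A : Set} (xs : List A) {f g : A → ℚ} → (∀ x → f x ≡ g x) →
    sumList xs f ≡ sumList xs g
  sumList-cong []       f≡g = refl
  sumList-cong (x ∷ xs) f≡g = cong₂ _+_ (f≡g x) (sumList-cong xs f≡g)

  sumList-0 : ∀ {A : Set} (xs : List A) → sumList xs (λ _ → 0ℚ) ≡ 0ℚ
  sumList-0 []       = refl
  sumList-0 (x ∷ xs) = trans (ℚ.+-identityˡ _) (sumList-0 xs)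

  length-filter : ∀ {A : Set} {P : A → Set} (P? : ∀ x → Dec (P x)) (xs : List A) →
    ℕtoℚ (length (filter P? xs)) ≡ sumList xs (λ x → 𝟙 (does (P? x)))
  length-filter P? []       = refl
  length-filter P? (x ∷ xs) with does (P? x)
  ... | true  = trans (ℕtoℚ-+ 1 (length (filter P? xs))) (cong (1ℚ +_) (length-filter P? xs))
  ... | false = trans (length-filter P? xs) (sym (ℚ.+-identityˡ _))

  sumList-allSubsets-suc : ∀ n (f : Subset (suc n) → ℚ) →
    sumList (allSubsets (suc n)) f
      ≡ sumList (allSubsets n) (f ∘ (inside ∷_)) + sumList (allSubsets n) (f ∘ (outside ∷_))
  sumList-allSubsets-suc n f =
    trans (sumList-++ (map (inside ∷_) A) (map (outside ∷_) A) f)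
          (cong₂ _+_ (sumList-map (inside ∷_) A f) (sumList-map (outside ∷_) A f))
    where
    A : List (Subset n)
    A = allSubsets n

  sumList-allSubsets : ∀ n l (F : Subset n → ℚ) →
    sumList (allSubsets n) (λ S → 𝟙 (∣ S ∣ ℕ.≡ᵇ l) * F S) ≡ sumOfSize n l F
  sumList-allSubsets zero    zero    F = trans (ℚ.+-identityʳ _) (ℚ.*-identityˡ (F []))
  sumList-allSubsets zero    (suc l) F = trans (ℚ.+-identityʳ _) (ℚ.*-zeroˡ (F []))
  sumList-allSubsets (suc n) zero    F = begin
    sumList (allSubsets (suc n)) (λ S → 𝟙 (∣ S ∣ ℕ.≡ᵇ 0) * F S)
      ≡⟨ sumList-allSubsets-suc n _ ⟩
    sumList A (λ S → 0ℚ * F (inside ∷ S)) + rest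
      ≡⟨ cong (_+ rest) (trans (sumList-cong A (λ S → ℚ.*-zeroˡ (F (inside ∷ S)))) (sumList-0 A)) ⟩
    0ℚ + rest
      ≡⟨ ℚ.+-identityˡ rest ⟩
    rest
      ≡⟨ sumList-allSubsets n zero (F ∘ (outside ∷_)) ⟩
    sumOfSize n zero (F ∘ (outside ∷_)) ∎
    where
    open ≡-Reasoning
    A : List (Subset n)
    A = allSubsets n
    rest : ℚ
    rest = sumList A (λ S → 𝟙 (∣ S ∣ ℕ.≡ᵇ 0) * F (outside ∷ S))
  sumList-allSubsets (suc n) (suc l) F =
    trans (sumList-allSubsets-suc n _)
          (cong₂ _+_ (sumList-allSubsets n l (F ∘ (inside ∷_)))
                     (sumList-allSubsets n (suc l) (F ∘ (outside ∷_))))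

  -- does ((∣ S ∣ ℕ.≟ l) ×-dec P? S) computes to (∣ S ∣ ℕ.≡ᵇ l) ∧ does (P? S).
  countSubsets≡sumOfSize : ∀ n l {P : Subset n → Set} (P? : ∀ S → Dec (P S)) →
    ℕtoℚ (countSubsets n l P P?) ≡ sumOfSize n l (λ S → 𝟙 (does (P? S)))
  countSubsets≡sumOfSize n l P? = begin
    ℕtoℚ (countSubsets n l _ P?)
      ≡⟨ length-filter _ (allSubsets n) ⟩
    sumList (allSubsets n) (λ S → 𝟙 ((∣ S ∣ ℕ.≡ᵇ l) ∧ does (P? S)))
      ≡⟨ sumList-cong (allSubsets n) (λ S → 𝟙-∧ (∣ S ∣ ℕ.≡ᵇ l) (does (P? S))) ⟩
    sumList (allSubsets n) (λ S → 𝟙 (∣ S ∣ ℕ.≡ᵇ l) * 𝟙 (does (P? S)))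
      ≡⟨ sumList-allSubsets n l _ ⟩
    sumOfSize n l (λ S → 𝟙 (does (P? S))) ∎
    where open ≡-Reasoning

  markov-count : ∀ n l {P : Subset n → Set} (P? : ∀ S → Dec (P S)) {c : ℚ} (F : Subset n → ℚ) →
    (∀ S → 0ℚ ≤ F S) → (∀ S → ¬ P S → c ≤ F S) →
    c * ℕtoℚ (n C l) ≤ sumOfSize n l F + c * ℕtoℚ (countSubsets n l P P?)
  markov-count n l P? {c} F 0≤F c≤F = begin
    c * ℕtoℚ (n C l)
      ≡⟨ sumOfSize-const n l c ⟨
    sumOfSize n l (λ _ → c)
      ≤⟨ sumOfSize-mono-≤ n l c≤F+c𝟙 ⟩
    sumOfSize n l (λ S → F S + c * 𝟙 (does (P? S)))
      ≡⟨ sumOfSize-+ n l F _ ⟩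
    sumOfSize n l F + sumOfSize n l (λ S → c * 𝟙 (does (P? S)))
      ≡⟨ cong (sumOfSize n l F +_) (sumOfSize-*ˡ n l c _) ⟩
    sumOfSize n l F + c * sumOfSize n l (λ S → 𝟙 (does (P? S)))
      ≡⟨ cong (λ k → sumOfSize n l F + c * k) (countSubsets≡sumOfSize n l P?) ⟨
    sumOfSize n l F + c * ℕtoℚ (countSubsets n l _ P?) ∎
    where
    open ℚ.≤-Reasoning
    c≤F+c𝟙 : ∀ S → c ≤ F S + c * 𝟙 (does (P? S))
    c≤F+c𝟙 S with P? S
    ... | yes _  = subst (λ x → c ≤ F S + x) (sym (ℚ.*-identityʳ c)) (p≤q+p (0≤F S))
    ... | no ¬PS =
      subst (c ≤_) (sym (trans (cong (F S +_) (ℚ.*-zeroʳ c)) (ℚ.+-identityʳ (F S)))) (c≤F S ¬PS)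

  -- Moments of the mass of a subset

  -- Numbers of l-subsets of [n] through one, resp. two, given points: (n-1 choose l-1) and
  -- (n-2 choose l-2), read as 0 when n or l is too small.
  through₁ : ℕ → ℕ → ℕ
  through₁ zero    l       = 0
  through₁ (suc n) zero    = 0
  through₁ (suc n) (suc l) = n C l

  through₂ : ℕ → ℕ → ℕ
  through₂ zero    l       = 0
  through₂ (suc n) zero    = 0
  through₂ (suc n) (suc l) = through₁ n l

  through₁-zero : ∀ n → through₁ n 0 ≡ 0
  through₁-zero zero    = refl
  through₁-zero (suc n) = refl

  through₂-zero : ∀ n → through₂ n 0 ≡ 0
  through₂-zero zero    = refl
  through₂-zero (suc n) = refl

  through₁-pascal : ∀ m l → through₁ (suc m) l ℕ.+ through₁ (suc m) (suc l) ≡ suc m C l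
  through₁-pascal m zero    = refl
  through₁-pascal m (suc l) = nCk+nC[k+1]≡[n+1]C[k+1] m l

  through₂-pascal : ∀ m l →
    through₂ (suc (suc m)) l ℕ.+ through₂ (suc (suc m)) (suc l) ≡ through₁ (suc (suc m)) l
  through₂-pascal m zero    = refl
  through₂-pascal m (suc l) = through₁-pascal m l

  through₂≤through₁ : ∀ n l → through₂ n l ℕ.≤ through₁ n l
  through₂≤through₁ zero          l             = ℕ.z≤n
  through₂≤through₁ (suc n)       zero          = ℕ.z≤n
  through₂≤through₁ (suc zero)    (suc l)       = ℕ.z≤n
  through₂≤through₁ (suc (suc m)) (suc zero)    = ℕ.z≤n
  through₂≤through₁ (suc (suc m)) (suc (suc l)) =
    subst (m C l ℕ.≤_) (nCk+nC[k+1]≡[n+1]C[k+1] m l) (ℕ.m≤m+n (m C l) _)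

  offDiagonalSum : (n : ℕ) → (Fin n → ℚ) → ℚ
  offDiagonalSum n f = sumFin n f * sumFin n f - normSq n f

  -- Pascal's rule fails for through₁ at n = 0 and for through₂ at n = 1, but there the
  -- weights sumFin and offDiagonalSum vanish.
  through₁-pascal-sum : ∀ n l (f : Fin n → ℚ) →
    (ℕtoℚ (through₁ n l) + ℕtoℚ (through₁ n (suc l))) * sumFin n f ≡ ℕtoℚ (n C l) * sumFin n f
  through₁-pascal-sum zero    l f = sym (ℚ.*-zeroʳ (ℕtoℚ (0 C l)))
  through₁-pascal-sum (suc m) l f =
    cong (_* sumFin (suc m) f)
      (trans (sym (ℕtoℚ-+ (through₁ (suc m) l) (through₁ (suc m) (suc l))))
             (cong ℕtoℚ (through₁-pascal m l)))

  offDiagonalSum-one-point : ∀ (f : Fin 1 → ℚ) → offDiagonalSum 1 f ≡ 0ℚ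
  offDiagonalSum-one-point f = no-pairs (f zero)
    where
    no-pairs : ∀ x → (x + 0ℚ) * (x + 0ℚ) - (x * x + 0ℚ) ≡ 0ℚ
    no-pairs = solve-∀ ℚ-ring

  through₂-pascal-offDiagonalSum : ∀ n l (f : Fin n → ℚ) →
    (ℕtoℚ (through₂ n l) + ℕtoℚ (through₂ n (suc l))) * offDiagonalSum n f
      ≡ ℕtoℚ (through₁ n l) * offDiagonalSum n f
  through₂-pascal-offDiagonalSum zero          l f = refl
  through₂-pascal-offDiagonalSum (suc zero)    l f rewrite offDiagonalSum-one-point f =
    trans (ℚ.*-zeroʳ (ℕtoℚ (through₂ 1 l) + ℕtoℚ (through₂ 1 (suc l))))
          (sym (ℚ.*-zeroʳ (ℕtoℚ (through₁ 1 l))))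
  through₂-pascal-offDiagonalSum (suc (suc m)) l f =
    cong (_* offDiagonalSum (suc (suc m)) f)
      (trans (sym (ℕtoℚ-+ (through₂ (suc (suc m)) l) (through₂ (suc (suc m)) (suc l))))
             (cong ℕtoℚ (through₂-pascal m l)))

  sumOfSize-mass : ∀ n l (p : Fin n → ℚ) → sumOfSize n l (mass n p) ≡ ℕtoℚ (through₁ n l) * sumFin n p
  sumOfSize-mass zero    zero    p = refl
  sumOfSize-mass zero    (suc l) p = refl
  sumOfSize-mass (suc n) zero    p = begin
    sumOfSize n 0 (mass (suc n) p ∘ (outside ∷_))
      ≡⟨ sumOfSize-cong n 0 (λ S _ → mass-outside n p S) ⟩
    sumOfSize n 0 (mass n (p ∘ suc))
      ≡⟨ sumOfSize-mass n 0 (p ∘ suc) ⟩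
    ℕtoℚ (through₁ n 0) * sumFin n (p ∘ suc)
      ≡⟨ cong (λ k → ℕtoℚ k * sumFin n (p ∘ suc)) (through₁-zero n) ⟩
    0ℚ * sumFin n (p ∘ suc)
      ≡⟨ trans (ℚ.*-zeroˡ (sumFin n (p ∘ suc))) (sym (ℚ.*-zeroˡ (sumFin (suc n) p))) ⟩
    0ℚ * sumFin (suc n) p ∎
    where open ≡-Reasoning
  sumOfSize-mass (suc n) (suc l) p = begin
    sumOfSize n l (mass (suc n) p ∘ (inside ∷_))
      + sumOfSize n (suc l) (mass (suc n) p ∘ (outside ∷_))
      ≡⟨ cong₂ _+_ (sumOfSize-cong n l (λ S _ → mass-inside n p S))
                   (sumOfSize-cong n (suc l) (λ S _ → mass-outside n p S)) ⟩
    sumOfSize n l (λ S → p₀ + mass n p′ S) + sumOfSize n (suc l) (mass n p′)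
      ≡⟨ cong₂ _+_ (trans (sumOfSize-+ n l (λ _ → p₀) (mass n p′))
                          (cong₂ _+_ (sumOfSize-const n l p₀) (sumOfSize-mass n l p′)))
                   (sumOfSize-mass n (suc l) p′) ⟩
    (p₀ * N + a * T) + a₊ * T
      ≡⟨ regroup p₀ N a a₊ T ⟩
    p₀ * N + (a + a₊) * T
      ≡⟨ cong (p₀ * N +_) (through₁-pascal-sum n l p′) ⟩
    p₀ * N + N * T
      ≡⟨ factor p₀ N T ⟩
    N * (p₀ + T) ∎
    where
    open ≡-Reasoning
    p′ : Fin n → ℚ
    p′ = p ∘ suc
    p₀ N a a₊ T : ℚ
    p₀ = p zero
    N = ℕtoℚ (n C l)
    a = ℕtoℚ (through₁ n l)
    a₊ = ℕtoℚ (through₁ n (suc l))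
    T = sumFin n p′
    regroup : ∀ x c a a₊ t → (x * c + a * t) + a₊ * t ≡ x * c + (a + a₊) * t
    regroup = solve-∀ ℚ-ring
    factor : ∀ x c t → x * c + c * t ≡ c * (x + t)
    factor = solve-∀ ℚ-ring

  sumOfSize-mass² : ∀ n l (p : Fin n → ℚ) →
    sumOfSize n l (λ S → mass n p S * mass n p S)
      ≡ ℕtoℚ (through₁ n l) * normSq n p + ℕtoℚ (through₂ n l) * offDiagonalSum n p
  sumOfSize-mass² zero    zero    p = refl
  sumOfSize-mass² zero    (suc l) p = refl
  sumOfSize-mass² (suc n) zero    p = begin
    sumOfSize n 0 (λ S → mass (suc n) p (outside ∷ S) * mass (suc n) p (outside ∷ S))
      ≡⟨ sumOfSize-cong n 0 (λ S _ → cong₂ _*_ (mass-outside n p S) (mass-outside n p S)) ⟩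
    sumOfSize n 0 (λ S → mass n p′ S * mass n p′ S)
      ≡⟨ sumOfSize-mass² n 0 p′ ⟩
    ℕtoℚ (through₁ n 0) * normSq n p′ + ℕtoℚ (through₂ n 0) * offDiagonalSum n p′
      ≡⟨ cong₂ (λ a b → ℕtoℚ a * normSq n p′ + ℕtoℚ b * offDiagonalSum n p′)
               (through₁-zero n) (through₂-zero n) ⟩
    0ℚ * normSq n p′ + 0ℚ * offDiagonalSum n p′
      ≡⟨ vanish (normSq n p′) (offDiagonalSum n p′) (normSq (suc n) p) (offDiagonalSum (suc n) p) ⟩
    0ℚ * normSq (suc n) p + 0ℚ * offDiagonalSum (suc n) p ∎
    where
    open ≡-Reasoning
    p′ : Fin n → ℚ
    p′ = p ∘ suc
    vanish : ∀ s d s′ d′ → 0ℚ * s + 0ℚ * d ≡ 0ℚ * s′ + 0ℚ * d′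
    vanish = solve-∀ ℚ-ring
  sumOfSize-mass² (suc n) (suc l) p = begin
    sumOfSize n l (λ S → X (inside ∷ S) * X (inside ∷ S))
      + sumOfSize n (suc l) (λ S → X (outside ∷ S) * X (outside ∷ S))
      ≡⟨ cong₂ _+_
           (sumOfSize-cong n l (λ S _ →
             trans (cong₂ _*_ (mass-inside n p S) (mass-inside n p S)) (square-sum p₀ (X′ S))))
           (sumOfSize-cong n (suc l) (λ S _ → cong₂ _*_ (mass-outside n p S) (mass-outside n p S))) ⟩
    sumOfSize n l (λ S → p₀ * p₀ + ((p₀ + p₀) * X′ S + X′ S * X′ S))
      + sumOfSize n (suc l) (λ S → X′ S * X′ S)
      ≡⟨ cong₂ _+_ inside-part (sumOfSize-mass² n (suc l) p′) ⟩
    (p₀ * p₀ * N + ((p₀ + p₀) * (a * T) + (a * s + b * P))) + (a₊ * s + b₊ * P)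
      ≡⟨ regroup p₀ N a a₊ b b₊ T s P ⟩
    p₀ * p₀ * N + (p₀ + p₀) * (a * T) + (a + a₊) * s + (b + b₊) * P
      ≡⟨ cong₂ (λ u v → p₀ * p₀ * N + (p₀ + p₀) * (a * T) + u + v)
               (through₁-pascal-sum n l (λ i → p′ i * p′ i)) (through₂-pascal-offDiagonalSum n l p′) ⟩
    p₀ * p₀ * N + (p₀ + p₀) * (a * T) + N * s + a * P
      ≡⟨ factor p₀ N a T s ⟩
    N * (p₀ * p₀ + s) + a * ((p₀ + T) * (p₀ + T) - (p₀ * p₀ + s)) ∎
    where
    open ≡-Reasoning
    p′ : Fin n → ℚ
    p′ = p ∘ suc
    X : Subset (suc n) → ℚ
    X = mass (suc n) p
    X′ : Subset n → ℚ
    X′ = mass n p′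
    p₀ N a a₊ b b₊ T s P : ℚ
    p₀ = p zero
    N = ℕtoℚ (n C l)
    a = ℕtoℚ (through₁ n l)
    a₊ = ℕtoℚ (through₁ n (suc l))
    b = ℕtoℚ (through₂ n l)
    b₊ = ℕtoℚ (through₂ n (suc l))
    T = sumFin n p′
    s = normSq n p′
    P = offDiagonalSum n p′
    inside-part : sumOfSize n l (λ S → p₀ * p₀ + ((p₀ + p₀) * X′ S + X′ S * X′ S))
                    ≡ p₀ * p₀ * N + ((p₀ + p₀) * (a * T) + (a * s + b * P))
    inside-part =
      trans (sumOfSize-+ n l (λ _ → p₀ * p₀) (λ S → (p₀ + p₀) * X′ S + X′ S * X′ S))
        (cong₂ _+_ (sumOfSize-const n l (p₀ * p₀))
          (trans (sumOfSize-+ n l (λ S → (p₀ + p₀) * X′ S) (λ S → X′ S * X′ S))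
            (cong₂ _+_ (trans (sumOfSize-*ˡ n l (p₀ + p₀) X′)
                              (cong ((p₀ + p₀) *_) (sumOfSize-mass n l p′)))
                       (sumOfSize-mass² n l p′))))
    square-sum : ∀ x y → (x + y) * (x + y) ≡ x * x + ((x + x) * y + y * y)
    square-sum = solve-∀ ℚ-ring
    regroup : ∀ x N a a₊ b b₊ T s P →
      (x * x * N + ((x + x) * (a * T) + (a * s + b * P))) + (a₊ * s + b₊ * P)
        ≡ x * x * N + (x + x) * (a * T) + (a + a₊) * s + (b + b₊) * P
    regroup = solve-∀ ℚ-ring
    factor : ∀ x N a T s →
      x * x * N + (x + x) * (a * T) + N * s + a * (T * T - s)
        ≡ N * (x * x + s) + a * ((x + T) * (x + T) - (x * x + s))
    factor = solve-∀ ℚ-ring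

  through₁-double-count : ∀ n l → ℕtoℚ (through₁ n l) * ℕtoℚ n ≡ ℕtoℚ l * ℕtoℚ (n C l)
  through₁-double-count n l = begin
    ℕtoℚ (through₁ n l) * ℕtoℚ n
      ≡⟨ cong (ℕtoℚ (through₁ n l) *_) (sumFin-ones n) ⟨
    ℕtoℚ (through₁ n l) * sumFin n ones
      ≡⟨ sumOfSize-mass n l ones ⟨
    sumOfSize n l (mass n ones)
      ≡⟨ sumOfSize-cong n l (λ S ∣S∣≡l → trans (mass-ones n S) (cong ℕtoℚ ∣S∣≡l)) ⟩
    sumOfSize n l (λ _ → ℕtoℚ l)
      ≡⟨ sumOfSize-const n l (ℕtoℚ l) ⟩
    ℕtoℚ l * ℕtoℚ (n C l) ∎
    where
    open ≡-Reasoning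
    ones : Fin n → ℚ
    ones _ = 1ℚ

  through₂-double-count : ∀ n l →
    ℕtoℚ (through₁ n l) * ℕtoℚ n + ℕtoℚ (through₂ n l) * (ℕtoℚ n * ℕtoℚ n - ℕtoℚ n)
      ≡ ℕtoℚ l * ℕtoℚ l * ℕtoℚ (n C l)
  through₂-double-count n l = begin
    a * ℕtoℚ n + b * (ℕtoℚ n * ℕtoℚ n - ℕtoℚ n)
      ≡⟨ cong₂ (λ s t → a * s + b * (t * t - s)) (normSq-ones n) (sumFin-ones n) ⟨
    a * normSq n ones + b * offDiagonalSum n ones
      ≡⟨ sumOfSize-mass² n l ones ⟨
    sumOfSize n l (λ S → mass n ones S * mass n ones S)
      ≡⟨ sumOfSize-cong n l (λ S ∣S∣≡l → cong₂ _*_ (size S ∣S∣≡l) (size S ∣S∣≡l)) ⟩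
    sumOfSize n l (λ _ → ℕtoℚ l * ℕtoℚ l)
      ≡⟨ sumOfSize-const n l (ℕtoℚ l * ℕtoℚ l) ⟩
    ℕtoℚ l * ℕtoℚ l * ℕtoℚ (n C l) ∎
    where
    open ≡-Reasoning
    a b : ℚ
    a = ℕtoℚ (through₁ n l)
    b = ℕtoℚ (through₂ n l)
    ones : Fin n → ℚ
    ones _ = 1ℚ
    size : ∀ S → ∣ S ∣ ≡ l → mass n ones S ≡ ℕtoℚ l
    size S ∣S∣≡l = trans (mass-ones n S) (cong ℕtoℚ ∣S∣≡l)

  sumOfSize-sqMass : ∀ n l (p : Fin n → ℚ) →
    ℕtoℚ n * sumOfSize n l (sqMass n p) ≡ ℕtoℚ l * ℕtoℚ (n C l) * normSq n p
  sumOfSize-sqMass n l p = begin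
    ν * sumOfSize n l (sqMass n p)  ≡⟨ cong (ν *_) (sumOfSize-mass n l (λ i → p i * p i)) ⟩
    ν * (a * normSq n p)            ≡⟨ reassoc ν a (normSq n p) ⟩
    a * ν * normSq n p              ≡⟨ cong (_* normSq n p) (through₁-double-count n l) ⟩
    ℕtoℚ l * ℕtoℚ (n C l) * normSq n p ∎
    where
    open ≡-Reasoning
    ν a : ℚ
    ν = ℕtoℚ n
    a = ℕtoℚ (through₁ n l)
    reassoc : ∀ x y z → x * (y * z) ≡ y * x * z
    reassoc = solve-∀ ℚ-ring

  deviation : (n l : ℕ) → (Fin n → ℚ) → Subset n → ℚ
  deviation n l p S = mass n p S * ℕtoℚ n - ℕtoℚ l

  variance-algebra : ∀ {ν L N s a b : ℚ} → a * ν ≡ L * N → a * ν + b * (ν * ν - ν) ≡ L * L * N →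
    b ≤ a → 0ℚ ≤ ν → 0ℚ ≤ b → 0ℚ ≤ s →
    ν * ν * (a * s + b * (1ℚ - s)) + (- ((ν + ν) * L) * a + L * L * N) ≤ ν * L * N * s
  variance-algebra {ν} {L} {N} {s} {a} {b} h₁ h₂ b≤a 0≤ν 0≤b 0≤s = begin
    E
      ≤⟨ p≤p+q (ℚ.+-mono-≤ (0≤p*q 0≤ν (p≤q⇒0≤q-p b≤a)) (0≤p*q (0≤p*q (0≤p*q 0≤ν 0≤ν) 0≤b) 0≤s)) ⟩
    E + (ν * (a - b) + ν * ν * b * s)
      ≡⟨ expand ν L N s a b ⟩
    ν * L * N * s + (ν * s - (L + L)) * (a * ν - L * N) + (a * ν + b * (ν * ν - ν) - L * L * N)
      ≡⟨ cong₂ (λ x y → ν * L * N * s + (ν * s - (L + L)) * (x - L * N) + (y - L * L * N)) h₁ h₂ ⟩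
    ν * L * N * s + (ν * s - (L + L)) * (L * N - L * N) + (L * L * N - L * L * N)
      ≡⟨ cancel ν L N s ⟩
    ν * L * N * s ∎
    where
    open ℚ.≤-Reasoning
    E : ℚ
    E = ν * ν * (a * s + b * (1ℚ - s)) + (- ((ν + ν) * L) * a + L * L * N)
    expand : ∀ ν L N s a b →
      ν * ν * (a * s + b * (1ℚ - s)) + (- ((ν + ν) * L) * a + L * L * N) + (ν * (a - b) + ν * ν * b * s)
        ≡ ν * L * N * s + (ν * s - (L + L)) * (a * ν - L * N) + (a * ν + b * (ν * ν - ν) - L * L * N)
    expand = solve-∀ ℚ-ring
    cancel : ∀ ν L N s →
      ν * L * N * s + (ν * s - (L + L)) * (L * N - L * N) + (L * L * N - L * L * N) ≡ ν * L * N * s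
    cancel = solve-∀ ℚ-ring

  sumOfSize-deviation² : ∀ n l (p : Fin n → ℚ) → sumFin n p ≡ 1ℚ →
    sumOfSize n l (λ S → deviation n l p S * deviation n l p S)
      ≤ ℕtoℚ n * ℕtoℚ l * ℕtoℚ (n C l) * normSq n p
  sumOfSize-deviation² n l p Σp≡1 = begin
    sumOfSize n l (λ S → deviation n l p S * deviation n l p S)
      ≡⟨ sumOfSize-cong n l (λ S _ → square-deviation (X S) ν L) ⟩
    sumOfSize n l (λ S → ν * ν * (X S * X S) + (κ * X S + L * L))
      ≡⟨ sumOfSize-+ n l (λ S → ν * ν * (X S * X S)) (λ S → κ * X S + L * L) ⟩
    sumOfSize n l (λ S → ν * ν * (X S * X S)) + sumOfSize n l (λ S → κ * X S + L * L)
      ≡⟨ cong₂ _+_ (trans (sumOfSize-*ˡ n l (ν * ν) (λ S → X S * X S)) (cong (ν * ν *_) second-moment))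
                   (trans (sumOfSize-+ n l (λ S → κ * X S) (λ _ → L * L))
                          (cong₂ _+_ (trans (sumOfSize-*ˡ n l κ X) (cong (κ *_) first-moment))
                                     (sumOfSize-const n l (L * L)))) ⟩
    ν * ν * (a * s + b * (1ℚ - s)) + (κ * a + L * L * N)
      ≤⟨ variance-algebra (through₁-double-count n l) (through₂-double-count n l)
           (ℕtoℚ-mono-≤ (through₂≤through₁ n l)) (0≤ℕtoℚ n) (0≤ℕtoℚ (through₂ n l)) (normSq-nonNeg n p) ⟩
    ν * L * N * s ∎
    where
    open ℚ.≤-Reasoning
    ν L N s a b κ : ℚ
    ν = ℕtoℚ n
    L = ℕtoℚ l
    N = ℕtoℚ (n C l)
    s = normSq n p
    a = ℕtoℚ (through₁ n l)
    b = ℕtoℚ (through₂ n l)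
    κ = - ((ν + ν) * L)
    X : Subset n → ℚ
    X = mass n p
    first-moment : sumOfSize n l X ≡ a
    first-moment = trans (sumOfSize-mass n l p) (trans (cong (a *_) Σp≡1) (ℚ.*-identityʳ a))
    second-moment : sumOfSize n l (λ S → X S * X S) ≡ a * s + b * (1ℚ - s)
    second-moment = trans (sumOfSize-mass² n l p) (cong (λ t → a * s + b * (t * t - s)) Σp≡1)
    square-deviation : ∀ x ν L →
      (x * ν - L) * (x * ν - L) ≡ ν * ν * (x * x) + (- ((ν + ν) * L) * x + L * L)
    square-deviation = solve-∀ ℚ-ring

  -- Chebyshev and Markov bounds

  c₁ : ℚ
  c₁ = ℤ.+ 1 / 2

  c₂ : ℚ
  c₂ = ℤ.+ 3 / 2

  K : ℚ
  K = ℕtoℚ 400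

  0<c₁ : 0ℚ < c₁
  0<c₁ = ℚ.positive⁻¹ c₁

  c₁*L≤e⇒L*L≤4*e*e : ∀ {L e : ℚ} → 0ℚ ≤ L → c₁ * L ≤ e → L * L ≤ ℕtoℚ 4 * (e * e)
  c₁*L≤e⇒L*L≤4*e*e {L} {e} 0≤L c₁L≤e = begin
    L * L                           ≡⟨ quarter L ⟩
    ℕtoℚ 4 * ((c₁ * L) * (c₁ * L))   ≤⟨ *-monoˡ-≤ (0≤ℕtoℚ 4) (*-mono-≤ 0≤c₁L c₁L≤e 0≤c₁L c₁L≤e) ⟩
    ℕtoℚ 4 * (e * e) ∎
    where
    open ℚ.≤-Reasoning
    0≤c₁L : 0ℚ ≤ c₁ * L
    0≤c₁L = 0≤p*q (ℚ.<⇒≤ 0<c₁) 0≤L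
    quarter : ∀ L → L * L ≡ ℕtoℚ 4 * ((c₁ * L) * (c₁ * L))
    quarter = solve-∀ ℚ-ring

  far-from-mean : ∀ {L m : ℚ} → 0ℚ ≤ L → ¬ (c₁ * L ≤ m) ⊎ ¬ (m ≤ c₂ * L) →
    L * L ≤ ℕtoℚ 4 * ((m - L) * (m - L))
  far-from-mean {L} {m} 0≤L (inj₁ below) =
    subst (λ x → L * L ≤ ℕtoℚ 4 * x) (flip m L) (c₁*L≤e⇒L*L≤4*e*e 0≤L c₁L≤L-m)
    where
    half : ∀ L → L - c₁ * L ≡ c₁ * L
    half = solve-∀ ℚ-ring
    flip : ∀ m L → (L - m) * (L - m) ≡ (m - L) * (m - L)
    flip = solve-∀ ℚ-ring
    c₁L≤L-m : c₁ * L ≤ L - m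
    c₁L≤L-m = subst (_≤ L - m) (half L) (ℚ.+-monoʳ-≤ L (ℚ.neg-antimono-≤ (ℚ.<⇒≤ (ℚ.≰⇒> below))))
  far-from-mean {L} {m} 0≤L (inj₂ above) = c₁*L≤e⇒L*L≤4*e*e 0≤L c₁L≤m-L
    where
    half : ∀ L → c₂ * L - L ≡ c₁ * L
    half = solve-∀ ℚ-ring
    c₁L≤m-L : c₁ * L ≤ m - L
    c₁L≤m-L = subst (_≤ m - L) (half L) (ℚ.+-monoˡ-≤ (- L) (ℚ.<⇒≤ (ℚ.≰⇒> above)))

  heavy-squares : ∀ {L ν X Y U : ℚ} → 0ℚ < L → 0ℚ ≤ ν → 0ℚ ≤ U → c₁ * L ≤ X * ν →
    ¬ (Y * L ≤ K * U * ν * (X * X)) → ℕtoℚ 100 * U * L ≤ ν * Y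
  heavy-squares {L} {ν} {X} {Y} {U} 0<L 0≤ν 0≤U c₁L≤Xν heavy = *-cancelˡ-≤ 0<L (begin
    L * (ℕtoℚ 100 * U * L)             ≡⟨ via-K L U ⟩
    K * U * ((c₁ * L) * (c₁ * L))      ≤⟨ *-monoˡ-≤ (0≤p*q (0≤ℕtoℚ 400) 0≤U)
                                                    (*-mono-≤ 0≤c₁L c₁L≤Xν 0≤c₁L c₁L≤Xν) ⟩
    K * U * ((X * ν) * (X * ν))        ≡⟨ regroup U X ν ⟩
    ν * (K * U * ν * (X * X))          ≤⟨ *-monoˡ-≤ 0≤ν (ℚ.<⇒≤ (ℚ.≰⇒> heavy)) ⟩
    ν * (Y * L)                        ≡⟨ rotate ν Y L ⟩
    L * (ν * Y) ∎)
    where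
    open ℚ.≤-Reasoning
    0≤c₁L : 0ℚ ≤ c₁ * L
    0≤c₁L = 0≤p*q (ℚ.<⇒≤ 0<c₁) (ℚ.<⇒≤ 0<L)
    via-K : ∀ L U → L * (ℕtoℚ 100 * U * L) ≡ K * U * ((c₁ * L) * (c₁ * L))
    via-K = solve-∀ ℚ-ring
    regroup : ∀ U X ν → K * U * ((X * ν) * (X * ν)) ≡ ν * (K * U * ν * (X * X))
    regroup = solve-∀ ℚ-ring
    rotate : ∀ ν Y L → ν * (Y * L) ≡ L * (ν * Y)
    rotate = solve-∀ ℚ-ring

  ¬-×-split : ∀ {A B C : Set} → Dec A → Dec B → ¬ ((A × B) × C) → (¬ A ⊎ ¬ B) ⊎ (A × ¬ C)
  ¬-×-split (no ¬a) _       _      = inj₁ (inj₁ ¬a)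
  ¬-×-split (yes a) (no ¬b) _      = inj₁ (inj₂ ¬b)
  ¬-×-split (yes a) (yes b) ¬[ab]c = inj₂ (a , λ c → ¬[ab]c ((a , b) , c))

  bad-subset-bound : ∀ {L ν X Y s U : ℚ} → 0ℚ < L → 0ℚ ≤ ν → 0ℚ ≤ s → s ≤ U → 0ℚ ≤ Y →
    ¬ (((c₁ * L ≤ X * ν) × (X * ν ≤ c₂ * L)) × (Y * L ≤ K * U * ν * (X * X))) →
    ℕtoℚ 100 * (L * L) * s ≤ ℕtoℚ 400 * s * ((X * ν - L) * (X * ν - L)) + L * ν * Y
  bad-subset-bound {L} {ν} {X} {Y} {s} {U} 0<L 0≤ν 0≤s s≤U 0≤Y bad =
    [ far-case , heavy-case ]′ (¬-×-split (c₁ * L ℚ.≤? X * ν) (X * ν ℚ.≤? c₂ * L) bad)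
    where
    open ℚ.≤-Reasoning
    0≤L : 0ℚ ≤ L
    0≤L = ℚ.<⇒≤ 0<L
    D² : ℚ
    D² = (X * ν - L) * (X * ν - L)
    far-case : ¬ (c₁ * L ≤ X * ν) ⊎ ¬ (X * ν ≤ c₂ * L) →
      ℕtoℚ 100 * (L * L) * s ≤ ℕtoℚ 400 * s * D² + L * ν * Y
    far-case far = begin
      ℕtoℚ 100 * (L * L) * s        ≡⟨ commute L s ⟩
      ℕtoℚ 100 * s * (L * L)        ≤⟨ *-monoˡ-≤ (0≤p*q (0≤ℕtoℚ 100) 0≤s) (far-from-mean 0≤L far) ⟩
      ℕtoℚ 100 * s * (ℕtoℚ 4 * D²)  ≡⟨ merge-constants s D² ⟩
      ℕtoℚ 400 * s * D²             ≤⟨ p≤p+q (0≤p*q (0≤p*q 0≤L 0≤ν) 0≤Y) ⟩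
      ℕtoℚ 400 * s * D² + L * ν * Y ∎
      where
      commute : ∀ L s → ℕtoℚ 100 * (L * L) * s ≡ ℕtoℚ 100 * s * (L * L)
      commute = solve-∀ ℚ-ring
      merge-constants : ∀ s d → ℕtoℚ 100 * s * (ℕtoℚ 4 * d) ≡ ℕtoℚ 400 * s * d
      merge-constants = solve-∀ ℚ-ring
    heavy-case : (c₁ * L ≤ X * ν) × ¬ (Y * L ≤ K * U * ν * (X * X)) →
      ℕtoℚ 100 * (L * L) * s ≤ ℕtoℚ 400 * s * D² + L * ν * Y
    heavy-case (c₁L≤Xν , heavy) = begin
      ℕtoℚ 100 * (L * L) * s    ≡⟨ regroup L s ⟩
      L * (ℕtoℚ 100 * s * L)    ≤⟨ *-monoˡ-≤ 0≤L (*-monoʳ-≤ 0≤L (*-monoˡ-≤ (0≤ℕtoℚ 100) s≤U)) ⟩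
      L * (ℕtoℚ 100 * U * L)
        ≤⟨ *-monoˡ-≤ 0≤L (heavy-squares {X = X} 0<L 0≤ν (ℚ.≤-trans 0≤s s≤U) c₁L≤Xν heavy) ⟩
      L * (ν * Y)               ≡⟨ ℚ.*-assoc L ν Y ⟨
      L * ν * Y                 ≤⟨ p≤q+p (0≤p*q (0≤p*q (0≤ℕtoℚ 400) 0≤s) (0≤p*p (X * ν - L))) ⟩
      ℕtoℚ 400 * s * D² + L * ν * Y ∎
      where
      regroup : ∀ L s → ℕtoℚ 100 * (L * L) * s ≡ L * (ℕtoℚ 100 * s * L)
      regroup = solve-∀ ℚ-ring

  good-fraction-algebra : ∀ {L s ν N G : ℚ} → 0ℚ < L → 0ℚ < s → 0ℚ ≤ N → ℕtoℚ 100 * s * ν ≤ L →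
    ℕtoℚ 100 * (L * L) * s * N
      ≤ ℕtoℚ 400 * s * (ν * L * N * s) + L * (L * N * s) + ℕtoℚ 100 * (L * L) * s * G →
    ℕtoℚ 95 * N ≤ ℕtoℚ 100 * G
  good-fraction-algebra {L} {s} {ν} {N} {G} 0<L 0<s 0≤N 100sν≤L markov = begin
    ℕtoℚ 95 * N                             ≡⟨ split-95 N ⟩
    ℕtoℚ 100 * N - ℕtoℚ 5 * N               ≤⟨ ℚ.+-monoˡ-≤ (- (ℕtoℚ 5 * N)) 100N≤5N+100G ⟩
    ℕtoℚ 5 * N + ℕtoℚ 100 * G - ℕtoℚ 5 * N  ≡⟨ cancel-5N N G ⟩
    ℕtoℚ 100 * G ∎
    where
    open ℚ.≤-Reasoning
    split-95 : ∀ N → ℕtoℚ 95 * N ≡ ℕtoℚ 100 * N - ℕtoℚ 5 * N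
    split-95 = solve-∀ ℚ-ring
    cancel-5N : ∀ N G → ℕtoℚ 5 * N + ℕtoℚ 100 * G - ℕtoℚ 5 * N ≡ ℕtoℚ 100 * G
    cancel-5N = solve-∀ ℚ-ring
    factor-c : ∀ L s N → L * L * s * (ℕtoℚ 100 * N) ≡ ℕtoℚ 100 * (L * L) * s * N
    factor-c = solve-∀ ℚ-ring
    factor-100sν : ∀ L s ν N r →
      ℕtoℚ 400 * s * (ν * L * N * s) + L * (L * N * s) + r
        ≡ ℕtoℚ 4 * (L * N * s) * (ℕtoℚ 100 * s * ν) + L * (L * N * s) + r
    factor-100sν = solve-∀ ℚ-ring
    collect : ∀ L s N G →
      ℕtoℚ 4 * (L * N * s) * L + L * (L * N * s) + ℕtoℚ 100 * (L * L) * s * G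
        ≡ L * L * s * (ℕtoℚ 5 * N + ℕtoℚ 100 * G)
    collect = solve-∀ ℚ-ring
    0≤L : 0ℚ ≤ L
    0≤L = ℚ.<⇒≤ 0<L
    0≤4LNs : 0ℚ ≤ ℕtoℚ 4 * (L * N * s)
    0≤4LNs = 0≤p*q (0≤ℕtoℚ 4) (0≤p*q (0≤p*q 0≤L 0≤N) (ℚ.<⇒≤ 0<s))
    c : ℚ
    c = ℕtoℚ 100 * (L * L) * s
    100N≤5N+100G : ℕtoℚ 100 * N ≤ ℕtoℚ 5 * N + ℕtoℚ 100 * G
    100N≤5N+100G = *-cancelˡ-≤ (0<p*q (0<p*q 0<L 0<L) 0<s) (begin
      L * L * s * (ℕtoℚ 100 * N)
        ≡⟨ factor-c L s N ⟩
      c * N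
        ≤⟨ markov ⟩
      ℕtoℚ 400 * s * (ν * L * N * s) + L * (L * N * s) + c * G
        ≡⟨ factor-100sν L s ν N (c * G) ⟩
      ℕtoℚ 4 * (L * N * s) * (ℕtoℚ 100 * s * ν) + L * (L * N * s) + c * G
        ≤⟨ ℚ.+-monoˡ-≤ (c * G) (ℚ.+-monoˡ-≤ (L * (L * N * s)) (*-monoˡ-≤ 0≤4LNs 100sν≤L)) ⟩
      ℕtoℚ 4 * (L * N * s) * L + L * (L * N * s) + c * G
        ≡⟨ collect L s N G ⟩
      L * L * s * (ℕtoℚ 5 * N + ℕtoℚ 100 * G) ∎)

  good-fraction : ∀ n (p : Fin n → ℚ) U l → IsDistribution n p → normSq n p ≤ U →
    ℕtoℚ 100 * U * ℕtoℚ n ≤ ℕtoℚ l →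
    ℕtoℚ 95 * ℕtoℚ (n C l)
      ≤ ℕtoℚ 100 * ℕtoℚ (countSubsets n l (Good c₁ c₂ K n p U l) (good? c₁ c₂ K n p U l))
  good-fraction n p U l (0≤p , Σp≡1) s≤U 100Uν≤L =
    good-fraction-algebra 0<L 0<s (0≤ℕtoℚ (n C l)) 100sν≤L (begin
      c * N
        ≤⟨ markov-count n l (good? c₁ c₂ K n p U l) F 0≤F c≤F ⟩
      sumOfSize n l F + c * G
        ≡⟨ cong (_+ c * G) sumOfSize-F ⟩
      ℕtoℚ 400 * s * sumOfSize n l D² + L * (ν * sumOfSize n l (sqMass n p)) + c * G
        ≤⟨ ℚ.+-monoˡ-≤ (c * G)
             (ℚ.+-mono-≤ (*-monoˡ-≤ (0≤p*q (0≤ℕtoℚ 400) 0≤s) (sumOfSize-deviation² n l p Σp≡1))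
                         (ℚ.≤-reflexive (cong (L *_) (sumOfSize-sqMass n l p)))) ⟩
      ℕtoℚ 400 * s * (ν * L * N * s) + L * (L * N * s) + c * G ∎)
    where
    open ℚ.≤-Reasoning
    ν L N s G c : ℚ
    ν = ℕtoℚ n
    L = ℕtoℚ l
    N = ℕtoℚ (n C l)
    s = normSq n p
    G = ℕtoℚ (countSubsets n l (Good c₁ c₂ K n p U l) (good? c₁ c₂ K n p U l))
    c = ℕtoℚ 100 * (L * L) * s
    D² F : Subset n → ℚ
    D² S = deviation n l p S * deviation n l p S
    F S = ℕtoℚ 400 * s * D² S + L * ν * sqMass n p S
    0<s : 0ℚ < s
    0<s = normSq-pos n 0≤p (subst (0ℚ <_) (sym Σp≡1) 0<1)
    0≤s : 0ℚ ≤ s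
    0≤s = ℚ.<⇒≤ 0<s
    0<L : 0ℚ < L
    0<L = ℚ.<-≤-trans
      (0<p*q (0<p*q (ℚ.positive⁻¹ (ℕtoℚ 100)) (ℚ.<-≤-trans 0<s s≤U)) (sum≡1⇒0<n n Σp≡1)) 100Uν≤L
    100sν≤L : ℕtoℚ 100 * s * ν ≤ L
    100sν≤L = ℚ.≤-trans (*-monoʳ-≤ (0≤ℕtoℚ n) (*-monoˡ-≤ (0≤ℕtoℚ 100) s≤U)) 100Uν≤L
    0≤F : ∀ S → 0ℚ ≤ F S
    0≤F S = ℚ.+-mono-≤ (0≤p*q (0≤p*q (0≤ℕtoℚ 400) 0≤s) (0≤p*p (deviation n l p S)))
                       (0≤p*q (0≤p*q (0≤ℕtoℚ l) (0≤ℕtoℚ n)) (sqMass-nonNeg n p S))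
    c≤F : ∀ S → ¬ Good c₁ c₂ K n p U l S → c ≤ F S
    c≤F S = bad-subset-bound {X = mass n p S} 0<L (0≤ℕtoℚ n) 0≤s s≤U (sqMass-nonNeg n p S)
    sumOfSize-F : sumOfSize n l F ≡ ℕtoℚ 400 * s * sumOfSize n l D² + L * (ν * sumOfSize n l (sqMass n p))
    sumOfSize-F =
      trans (sumOfSize-+ n l (λ S → ℕtoℚ 400 * s * D² S) (λ S → L * ν * sqMass n p S))
            (cong₂ _+_ (sumOfSize-*ˡ n l (ℕtoℚ 400 * s) D²)
                       (trans (sumOfSize-*ˡ n l (L * ν) (sqMass n p)) (ℚ.*-assoc L ν _)))

open import Data.Nat using (ℕ; _≤_)
import Data.Nat as N
open import Data.Nat.Combinatorics using (_C_)
open import Data.Rational using (ℚ; 0ℚ; _<_; _*_)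
import Data.Rational as Q
open import Data.Fin using (Fin)
open import Data.Product using (Σ; _×_)

mainTheorem10 :
    Σ ℚ λ c₁ → Σ ℚ λ c₂ → Σ ℚ λ K → (0ℚ < c₁) ×
      ((n : ℕ) (p : Fin n → ℚ) (U : ℚ) (l : ℕ) →
        IsDistribution n p →
        normSq n p Q.≤ U →
        l ≤ n →
        ℕtoℚ 100 * U * ℕtoℚ n Q.≤ ℕtoℚ l →
        95 N.* (n C l) ≤ 100 N.* countSubsets n l (Good c₁ c₂ K n p U l) (good? c₁ c₂ K n p U l))
mainTheorem10 = c₁ , c₂ , K , 0<c₁ , λ n p U l p-dist s≤U _ 100Un≤l →
  ℕtoℚ-cancel-≤ (subst₂ Q._≤_ (sym (ℕtoℚ-* 95 (n C l)))
                              (sym (ℕtoℚ-* 100 (countSubsets n l _ (good? c₁ c₂ K n p U l))))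
                              (good-fraction n p U l p-dist s≤U 100Un≤l))
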